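{- Let $q,k \in \mathbb{N}$ with $2 \le q \le k/2$. The inequality \[ \sum_{i \in \mathbb{Z}_k} \left( x_{\{i,i+1\}} - x_{\{i,i+q\}} \right) \le k - \left\lceil \tfrac{k}{q} \right\rceil \] is a Chvátal–Gomory cut with respect to the system consisting of the box inequalities $0 \le x_{\{i,j\}} \le 1$ for all $\{i,j\}\in E_k$ and the triangle inequalities $x_{\{i,j\}}+x_{\{j,l\}}-x_{\{i,l\}} \le 1$ for all pairwise distinct $i,j,l \in \mathbb{Z}_k$. In particular, it is valid for the clique partitioning polytope $\mathrm{CPP}_k$.
   Context: $K_k=(\mathbb{Z}_k,E_k)$ is the complete graph on node set $\mathbb{Z}_k$ (integers mod $k$), $E_k=\binom{\mathbb{Z}_k}{2}$, and indices are taken modulo $k$. The clique partitioning polytope $\mathrm{CPP}_k$ is the convex hull of all $x\in\{0,1\}^{E_k}$ satisfying the triangle inequalities above (equivalently, of the characteristic vectors of edge sets $\{\{i,j\}: i,j \text{ in the same block of } \Pi\}$ for partitions $\Pi$ of $\mathbb{Z}_k$). A Chvátal–Gomory cut of a system $Ax\le b$ is an inequality $\lambda^\top A x \le \lfloor \lambda^\top b\rfloor$ with $\lambda\ge 0$ and $\lambda^\top A$ integral. -}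

module Defs where

open import Data.Nat as ℕ using (ℕ; zero; suc)
open import Data.Nat.DivMod using (_mod_)
open import Data.Fin as Fin using (Fin; toℕ)
open import Data.Bool using (Bool; true; false; if_then_else_; _∧_; _∨_; not)
open import Data.Integer as ℤ using (ℤ)
open import Data.Rational as ℚ using (ℚ; 0ℚ; 1ℚ; _+_; _*_; -_; _-_; floor; ceiling)
open import Data.List using (List; []; _∷_)
open import Data.Product using (_×_; _,_)
open import Relation.Nullary using (does)
open import Data.Sum using (_⊎_)

sumFin : (n : ℕ) → (Fin n → ℚ) → ℚ
sumFin zero    f = 0ℚ
sumFin (suc n) f = f Fin.zero + sumFin n (λ i → f (Fin.suc i))

ind : Bool → ℚ
ind b = if b then 1ℚ else 0ℚ

shift : {k : ℕ} → Fin k → ℕ → Fin k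
shift {suc n} i d = (toℕ i ℕ.+ d) mod (suc n)

_==_ : {k : ℕ} → Fin k → Fin k → Bool
i == j = does (i Fin.≟ j)

_<ᵇ_ : {k : ℕ} → Fin k → Fin k → Bool
i <ᵇ j = does (i Fin.<? j)

samePair : {k : ℕ} → Fin k → Fin k → Fin k → Fin k → Bool
samePair a b i j = ((a == i) ∧ (b == j)) ∨ ((a == j) ∧ (b == i))

distinct3 : {k : ℕ} → Fin k → Fin k → Fin k → Bool
distinct3 a b c = not (a == b) ∧ not (b == c) ∧ not (a == c)

-- Edges of K_k are represented by ordered pairs (i,j) with i < j.
-- A vector in ℚ^{E_k} is a function Fin k → Fin k → ℚ of which only the
-- entries with i < j matter.
sumEdges : (k : ℕ) → (Fin k → Fin k → ℚ) → ℚ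
sumEdges k f = sumFin k (λ i → sumFin k (λ j → if i <ᵇ j then f i j else 0ℚ))

sumTriples : (k : ℕ) → (Fin k → Fin k → Fin k → ℚ) → ℚ
sumTriples k f = sumFin k (λ a → sumFin k (λ b → sumFin k (λ c →
  if distinct3 a b c then f a b c else 0ℚ)))

-- Entry x_{{a,b}} of an edge vector x (for a ≠ b).
entry : {k : ℕ} → (Fin k → Fin k → ℚ) → Fin k → Fin k → ℚ
entry x a b = if a <ᵇ b then x a b else x b a

-- Rows:  (lower e)   - x_e ≤ 0             for every edge e
--        (upper e)     x_e ≤ 1             for every edge e
--        (tri i j l)   x_{ij} + x_{jl} - x_{il} ≤ 1   for i,j,l pairwise distinct
-- Multipliers: μlo, μup on edges, τ on ordered triples.

triCoeff : {k : ℕ} → Fin k → Fin k → Fin k → Fin k → Fin k → ℚ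
triCoeff a b c i j =
  ind (samePair a b i j) + ind (samePair b c i j) - ind (samePair a c i j)

combCoeff : (k : ℕ) → (μlo μup : Fin k → Fin k → ℚ)
          → (τ : Fin k → Fin k → Fin k → ℚ) → Fin k → Fin k → ℚ
combCoeff k μlo μup τ i j =
  (- μlo i j) + μup i j + sumTriples k (λ a b c → τ a b c * triCoeff a b c i j)

combRhs : (k : ℕ) → (μlo μup : Fin k → Fin k → ℚ)
        → (τ : Fin k → Fin k → Fin k → ℚ) → ℚ
combRhs k μlo μup τ = sumEdges k μup + sumTriples k (λ a b c → τ a b c)

cutCoeff : (k q : ℕ) → Fin k → Fin k → ℚ
cutCoeff k q i j = sumFin k (λ t →
  ind (samePair t (shift t 1) i j) - ind (samePair t (shift t q) i j))

-- ⌈k/q⌉ (q = 0 never occurs under the hypotheses).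
ceilDiv : ℕ → ℕ → ℤ
ceilDiv k zero    = ℤ.+ 0
ceilDiv k (suc p) = ceiling (ℤ.+ k ℚ./ suc p)

cutRhs : ℕ → ℕ → ℤ
cutRhs k q = ℤ.+ k ℤ.- ceilDiv k q

cutLhs : (k q : ℕ) → (Fin k → Fin k → ℚ) → ℚ
cutLhs k q x = sumFin k (λ t → entry x t (shift t 1) - entry x t (shift t q))

open import Data.Product using (Σ; ∃; ∃-syntax)
open import Relation.Binary.PropositionalEquality using (_≡_)

record IsCGCut (k : ℕ) (c : Fin k → Fin k → ℚ) (r : ℤ) : Set where
  field
    μlo μup : Fin k → Fin k → ℚ
    τ       : Fin k → Fin k → Fin k → ℚ
    μlo≥0   : ∀ i j → 0ℚ ℚ.≤ μlo i j
    μup≥0   : ∀ i j → 0ℚ ℚ.≤ μup i j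
    τ≥0     : ∀ a b c → 0ℚ ℚ.≤ τ a b c
    coeffs  : ∀ i j → i Fin.< j → combCoeff k μlo μup τ i j ≡ c i j
    rhs     : floor (combRhs k μlo μup τ) ≡ r

record IsCPPVertex (k : ℕ) (x : Fin k → Fin k → ℚ) : Set where
  field
    binary   : ∀ i j → i Fin.< j → (x i j ≡ 0ℚ) ⊎ (x i j ≡ 1ℚ)
    triangle : ∀ a b c → distinct3 a b c ≡ true →
               entry x a b + entry x b c - entry x a c ℚ.≤ 1ℚ

-- A (rational) point of CPP_k is a finite convex combination of vertices.
sumW : {k : ℕ} → List (ℚ × (Fin k → Fin k → ℚ)) → ℚ
sumW []             = 0ℚ
sumW ((w , _) ∷ ws) = w + sumW ws

combo : {k : ℕ} → List (ℚ × (Fin k → Fin k → ℚ)) → Fin k → Fin k → ℚ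
combo []             i j = 0ℚ
combo ((w , v) ∷ ws) i j = w * v i j + combo ws i j

data AllConvex {k : ℕ} : List (ℚ × (Fin k → Fin k → ℚ)) → Set where
  []  : AllConvex []
  _∷_ : ∀ {w v ws} → (0ℚ ℚ.≤ w) × IsCPPVertex k v → AllConvex ws → AllConvex ((w , v) ∷ ws)

InCPP : (k : ℕ) → (Fin k → Fin k → ℚ) → Set
InCPP k x = Σ (List (ℚ × (Fin k → Fin k → ℚ))) λ L →
  AllConvex L × (sumW L ≡ 1ℚ) × (∀ i j → i Fin.< j → x i j ≡ combo L i j)

module Submission where

-- Chvátal–Gomory certificate: weight 1/q on each triangle inequality of the fans (i, i+j, i+j+1),
-- 1 ≤ j ≤ q-1, and weight (q-1)/q on each lower bound -x_{i,i+q} ≤ 0. The fan at i telescopes to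
-- x_{i,i+1} + … + x_{i+q-1,i+q} - x_{i,i+q}, so all fans together give q Σ x_{i,i+1} - Σ x_{i,i+q};
-- with the weights this is exactly the left-hand side of the cut, while the right-hand side becomes
-- k(q-1)/q = k - k/q, whose floor is k - ⌈k/q⌉. Validity on CPP_k: at a vertex the same estimate
-- bounds the integral left-hand side by k - k/q, hence by its floor, and the bound passes to convex
-- combinations.

module FanCertificate where

  open import Defs
  open import Data.Nat as ℕ using (ℕ; zero; suc; z≤n; s≤s; _%_; _/_)
  import Data.Nat.Properties as ℕP
  open import Data.Nat.DivMod using (%-distribˡ-+; m%n%n≡m%n; m<n⇒m%n≡m; m≡m%n+[m/n]*n; n%n≡0)
  open import Data.Fin as Fin using (Fin; toℕ; inject₁; fromℕ)
  import Data.Fin.Properties as FinP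
  open import Data.Bool using (true; false; if_then_else_; not; _∧_; T)
  open import Data.Integer as ℤ using (ℤ; 1ℤ)
  import Data.Integer.Properties as ℤP
  import Data.Integer.DivMod as ℤD
  import Data.Integer.Solver as ℤSolver
  open import Data.Rational as ℚ using (ℚ; 0ℚ; 1ℚ; _+_; _*_; -_; _-_; floor; mkℚ; *≤*; *<*)
  open import Data.Rational.Literals using (fromℤ)
  open import Data.Rational.Properties
  import Data.Rational.Unnormalised as ℚᵘ
  import Data.Rational.Unnormalised.Properties as ℚᵘP
  open import Data.Rational.Solver using (module +-*-Solver)
  open import Data.List using (List; []; _∷_)
  open import Data.Product using (_×_; _,_; ∃-syntax; ∃₂)
  open import Data.Sum using (_⊎_; inj₁; inj₂)
  open import Data.Unit using (tt)
  open import Relation.Binary.PropositionalEquality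
  open import Relation.Nullary.Decidable using (dec-false)
  open import Function using (_∘_)

  open +-*-Solver
  private module ℤS = ℤSolver.+-*-Solver

  sumFin-cong : ∀ n {f g : Fin n → ℚ} → (∀ i → f i ≡ g i) → sumFin n f ≡ sumFin n g
  sumFin-cong zero    eq = refl
  sumFin-cong (suc n) eq = cong₂ _+_ (eq Fin.zero) (sumFin-cong n (λ i → eq (Fin.suc i)))

  sumFin-zero : ∀ n → sumFin n (λ _ → 0ℚ) ≡ 0ℚ
  sumFin-zero zero    = refl
  sumFin-zero (suc n) = cong (0ℚ +_) (sumFin-zero n)

  sumFin-+ : ∀ n (f g : Fin n → ℚ) → sumFin n (λ i → f i + g i) ≡ sumFin n f + sumFin n g
  sumFin-+ zero    f g = refl
  sumFin-+ (suc n) f g = trans (cong (f Fin.zero + g Fin.zero +_) (sumFin-+ n _ _))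
    (solve 4 (λ a b c d → (a :+ b) :+ (c :+ d) := (a :+ c) :+ (b :+ d)) refl
       (f Fin.zero) (g Fin.zero) (sumFin n (λ i → f (Fin.suc i))) (sumFin n (λ i → g (Fin.suc i))))

  sumFin-- : ∀ n (f g : Fin n → ℚ) → sumFin n (λ i → f i - g i) ≡ sumFin n f - sumFin n g
  sumFin-- zero    f g = refl
  sumFin-- (suc n) f g = trans (cong (f Fin.zero - g Fin.zero +_) (sumFin-- n _ _))
    (solve 4 (λ a b c d → (a :- b) :+ (c :- d) := (a :+ c) :- (b :+ d)) refl
       (f Fin.zero) (g Fin.zero) (sumFin n (λ i → f (Fin.suc i))) (sumFin n (λ i → g (Fin.suc i))))

  sumFin-*ˡ : ∀ n c (f : Fin n → ℚ) → sumFin n (λ i → c * f i) ≡ c * sumFin n f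
  sumFin-*ˡ zero    c f = sym (*-zeroʳ c)
  sumFin-*ˡ (suc n) c f = trans (cong (c * f Fin.zero +_) (sumFin-*ˡ n c _))
    (sym (*-distribˡ-+ c (f Fin.zero) _))

  sumFin-*ʳ : ∀ n c (f : Fin n → ℚ) → sumFin n (λ i → f i * c) ≡ sumFin n f * c
  sumFin-*ʳ n c f = trans (sumFin-cong n (λ i → *-comm (f i) c))
    (trans (sumFin-*ˡ n c f) (*-comm c (sumFin n f)))

  sumFin-comm : ∀ m n (f : Fin m → Fin n → ℚ) →
    sumFin m (λ i → sumFin n (f i)) ≡ sumFin n (λ j → sumFin m (λ i → f i j))
  sumFin-comm zero    n f = sym (sumFin-zero n)
  sumFin-comm (suc m) n f = trans (cong (sumFin n (f Fin.zero) +_) (sumFin-comm m n _))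
    (sym (sumFin-+ n (f Fin.zero) _))

  sumFin-last : ∀ n (f : Fin (suc n) → ℚ) → sumFin (suc n) f ≡ sumFin n (λ i → f (inject₁ i)) + f (fromℕ n)
  sumFin-last zero    f = trans (+-identityʳ (f Fin.zero)) (sym (+-identityˡ (f Fin.zero)))
  sumFin-last (suc n) f = trans (cong (f Fin.zero +_) (sumFin-last n (λ i → f (Fin.suc i))))
    (sym (+-assoc (f Fin.zero) _ _))

  sumFin-telescope : ∀ p (a b : ℕ → ℚ) →
    sumFin p (λ j → a (toℕ j) + b (toℕ j) - a (suc (toℕ j))) ≡ a 0 - a p + sumFin p (λ j → b (toℕ j))
  sumFin-telescope zero    a b = solve 1 (λ a₀ → con 0ℚ := a₀ :- a₀ :+ con 0ℚ) refl (a 0)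
  sumFin-telescope (suc p) a b =
    trans (cong (a 0 + b 0 - a 1 +_) (sumFin-telescope p (λ m → a (suc m)) (λ m → b (suc m))))
      (solve 5 (λ a₀ b₀ a₁ aₚ s → a₀ :+ b₀ :- a₁ :+ (a₁ :- aₚ :+ s) := a₀ :- aₚ :+ (b₀ :+ s)) refl
        (a 0) (b 0) (a 1) (a (suc p)) (sumFin p (λ j → b (suc (toℕ j)))))

  ι : ℤ → ℚ
  ι = fromℤ

  ι-+ : ∀ a b → ι (a ℤ.+ b) ≡ ι a + ι b
  ι-+ a b = toℚᵘ-injective (ℚᵘP.≃-sym (ℚᵘP.≃-trans (toℚᵘ-homo-+ (ι a) (ι b))
    (ℚᵘ.*≡* (ℤS.solve 2 (λ a b → (a ℤS.:* ℤS.con 1ℤ ℤS.:+ b ℤS.:* ℤS.con 1ℤ) ℤS.:* ℤS.con 1ℤ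
                                  ℤS.:= (a ℤS.:+ b) ℤS.:* ℤS.con 1ℤ) refl a b))))

  sumFin-const : ∀ n c → sumFin n (λ _ → c) ≡ ι (ℤ.+ n) * c
  sumFin-const zero    c = sym (*-zeroˡ c)
  sumFin-const (suc n) c = begin
    c + sumFin n (λ _ → c)   ≡⟨ cong (c +_) (sumFin-const n c) ⟩
    c + ι (ℤ.+ n) * c        ≡⟨ solve 2 (λ c m → c :+ m :* c := (con 1ℚ :+ m) :* c) refl c (ι (ℤ.+ n)) ⟩
    (1ℚ + ι (ℤ.+ n)) * c     ≡⟨ cong (_* c) (sym (ι-+ 1ℤ (ℤ.+ n))) ⟩
    ι (ℤ.+ suc n) * c        ∎
    where open ≡-Reasoning

  sumFin-mono-≤ : ∀ n {f g : Fin n → ℚ} → (∀ i → f i ℚ.≤ g i) → sumFin n f ℚ.≤ sumFin n g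
  sumFin-mono-≤ zero    le = ≤-refl
  sumFin-mono-≤ (suc n) le = +-mono-≤ (le Fin.zero) (sumFin-mono-≤ n (λ i → le (Fin.suc i)))

  sumFin-nonNeg : ∀ n {f : Fin n → ℚ} → (∀ i → 0ℚ ℚ.≤ f i) → 0ℚ ℚ.≤ sumFin n f
  sumFin-nonNeg n nonNeg = ≤-trans (≤-reflexive (sym (sumFin-zero n))) (sumFin-mono-≤ n nonNeg)

  sumFin-δ : ∀ n (γ : Fin n) (f : Fin n → ℚ) → sumFin n (λ c → ind (c == γ) * f c) ≡ f γ
  sumFin-δ (suc n) Fin.zero f = begin
    1ℚ * f Fin.zero + sumFin n (λ c → 0ℚ * f (Fin.suc c))
      ≡⟨ cong₂ _+_ (*-identityˡ (f Fin.zero))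
           (trans (sumFin-cong n (λ c → *-zeroˡ (f (Fin.suc c)))) (sumFin-zero n)) ⟩
    f Fin.zero + 0ℚ
      ≡⟨ +-identityʳ (f Fin.zero) ⟩
    f Fin.zero ∎
    where open ≡-Reasoning
  sumFin-δ (suc n) (Fin.suc γ) f =
    trans (cong (_+ rest) (*-zeroˡ (f Fin.zero)))
      (trans (+-identityˡ rest) (sumFin-δ n γ (λ c → f (Fin.suc c))))
    where rest = sumFin n (λ c → ind (c == γ) * f (Fin.suc c))

  ind-nonNeg : ∀ b → 0ℚ ℚ.≤ ind b
  ind-nonNeg true  = *≤* (ℤ.+≤+ z≤n)
  ind-nonNeg false = ≤-refl

  *-nonNeg : ∀ {a b} → 0ℚ ℚ.≤ a → 0ℚ ℚ.≤ b → 0ℚ ℚ.≤ a * b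
  *-nonNeg {a} {b} a≥0 b≥0 = ≤-trans (≤-reflexive (sym (*-zeroˡ b)))
    (*-monoʳ-≤-nonNeg b {{ℚ.nonNegative b≥0}} a≥0)

  ι-neg : ∀ a → ι (ℤ.- a) ≡ - ι a
  ι-neg a = toℚᵘ-injective (ℚᵘP.≃-sym (toℚᵘ-homo‿- (ι a)))

  ι-mono-≤ : ∀ {a b} → a ℤ.≤ b → ι a ℚ.≤ ι b
  ι-mono-≤ {a} {b} le = *≤* (subst₂ ℤ._≤_ (sym (ℤP.*-identityʳ a)) (sym (ℤP.*-identityʳ b)) le)

  ι-cancel-< : ∀ {a b} → ι a ℚ.< ι b → a ℤ.< b
  ι-cancel-< {a} {b} (*<* lt) = subst₂ ℤ._<_ (ℤP.*-identityʳ a) (ℤP.*-identityʳ b) lt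

  /1≡ι : ∀ z → z ℚ./ 1 ≡ ι z
  /1≡ι z = toℚᵘ-injective (toℚᵘ-fromℚᵘ (ℚᵘ.mkℚᵘ z 0))

  /-*-cancel : ∀ z d → (z ℚ./ suc d) * ι (ℤ.+ suc d) ≡ ι z
  /-*-cancel z d = toℚᵘ-injective (ℚᵘP.≃-trans (toℚᵘ-homo-* (z ℚ./ suc d) (ι (ℤ.+ suc d)))
    (ℚᵘP.≃-trans (ℚᵘP.*-congʳ {ℚᵘ.mkℚᵘ (ℤ.+ suc d) 0} (toℚᵘ-fromℚᵘ (ℚᵘ.mkℚᵘ z d)))
      (ℚᵘ.*≡* (trans (ℤP.*-identityʳ _)
        (cong (λ e → z ℤ.* ℤ.+ suc e) (sym (ℕP.*-identityʳ d)))))))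

  i<suc[j]⇒i≤j : ∀ {i j} → i ℤ.< ℤ.suc j → i ℤ.≤ j
  i<suc[j]⇒i≤j {i} {j} lt = subst (i ℤ.≤_) (ℤP.pred-suc j) (ℤP.i<j⇒i≤pred[j] lt)

  floor-≤ : ∀ p → ι (floor p) ℚ.≤ p
  floor-≤ p@(mkℚ n d-1 _) = *≤* (begin
    floor p ℤ.* d                      ≤⟨ ℤP.i≤j+i _ (ℤ.+ (n ℤD.% d)) ⟩
    ℤ.+ (n ℤD.% d) ℤ.+ floor p ℤ.* d   ≡⟨ ℤD.a≡a%n+[a/n]*n n d ⟨
    n                                  ≡⟨ ℤP.*-identityʳ n ⟨
    n ℤ.* 1ℤ                           ∎)
    where
    open ℤP.≤-Reasoning
    d = ℤ.+ suc d-1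

  floor-< : ∀ p → p ℚ.< ι (ℤ.suc (floor p))
  floor-< p@(mkℚ n d-1 _) = *<* (begin-strict
    n ℤ.* 1ℤ                            ≡⟨ ℤP.*-identityʳ n ⟩
    n                                   ≡⟨ ℤD.a≡a%n+[a/n]*n n d ⟩
    ℤ.+ (n ℤD.% d) ℤ.+ floor p ℤ.* d    <⟨ ℤP.+-monoˡ-< (floor p ℤ.* d) (ℤ.+<+ (ℤD.n%d<d n d)) ⟩
    d ℤ.+ floor p ℤ.* d                 ≡⟨ ℤP.suc-* (floor p) d ⟨
    ℤ.suc (floor p) ℤ.* d               ∎)
    where
    open ℤP.≤-Reasoning
    d = ℤ.+ suc d-1

  ≤-floor : ∀ {z p} → ι z ℚ.≤ p → z ℤ.≤ floor p
  ≤-floor {p = p} le = i<suc[j]⇒i≤j (ι-cancel-< (≤-<-trans le (floor-< p)))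

  floor-unique : ∀ {p} z → ι z ℚ.≤ p → p ℚ.< ι (ℤ.suc z) → floor p ≡ z
  floor-unique {p} z le lt = ℤP.≤-antisym
    (i<suc[j]⇒i≤j (ι-cancel-< (≤-<-trans (floor-≤ p) lt)))
    (≤-floor le)

  floor-ι+ : ∀ z p → floor (ι z + p) ≡ z ℤ.+ floor p
  floor-ι+ z p = floor-unique (z ℤ.+ floor p)
    (≤-trans (≤-reflexive (ι-+ z (floor p))) (+-monoʳ-≤ (ι z) (floor-≤ p)))
    (<-≤-trans (+-monoʳ-< (ι z) (floor-< p))
      (≤-reflexive (trans (sym (ι-+ z (ℤ.suc (floor p))))
        (cong ι (ℤS.solve 2 (λ z f → z ℤS.:+ (ℤS.con 1ℤ ℤS.:+ f) ℤS.:= ℤS.con 1ℤ ℤS.:+ (z ℤS.:+ f))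
                   refl z (floor p))))))

  ceiling≡-floor- : ∀ x → ℚ.ceiling x ≡ ℤ.- floor (- x)
  ceiling≡-floor- (mkℚ _ _ _) = refl

  Integral : ℚ → Set
  Integral x = ∃[ z ] x ≡ ι z

  integral-+ : ∀ {x y} → Integral x → Integral y → Integral (x + y)
  integral-+ (a , refl) (b , refl) = a ℤ.+ b , sym (ι-+ a b)

  integral-- : ∀ {x y} → Integral x → Integral y → Integral (x - y)
  integral-- (a , refl) (b , refl) = a ℤ.- b , sym (trans (ι-+ a (ℤ.- b)) (cong (ι a +_) (ι-neg b)))

  integral-sumFin : ∀ n {f : Fin n → ℚ} → (∀ i → Integral (f i)) → Integral (sumFin n f)
  integral-sumFin zero    _ = ℤ.+ 0 , refl
  integral-sumFin (suc n) h = integral-+ (h Fin.zero) (integral-sumFin n (λ i → h (Fin.suc i)))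

  integral-≤-floor : ∀ {x p} → Integral x → x ℚ.≤ p → x ℚ.≤ ι (floor p)
  integral-≤-floor (z , refl) le = ι-mono-≤ (≤-floor le)

  Binary : ℚ → Set
  Binary x = x ≡ 0ℚ ⊎ x ≡ 1ℚ

  binary⇒integral : ∀ {x} → Binary x → Integral x
  binary⇒integral (inj₁ refl) = ℤ.+ 0 , refl
  binary⇒integral (inj₂ refl) = ℤ.+ 1 , refl

  binary⇒nonNeg : ∀ {x} → Binary x → 0ℚ ℚ.≤ x
  binary⇒nonNeg (inj₁ refl) = ≤-refl
  binary⇒nonNeg (inj₂ refl) = ind-nonNeg true

  module _ {n : ℕ} where

    private
      k = suc n

    toℕ-shift : ∀ (i : Fin k) d → toℕ (shift i d) ≡ (toℕ i ℕ.+ d) ℕ.% k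
    toℕ-shift i d = FinP.toℕ-fromℕ< _

    shift-+ : ∀ (i : Fin k) a b → shift (shift i a) b ≡ shift i (a ℕ.+ b)
    shift-+ i a b = FinP.toℕ-injective (begin
      toℕ (shift (shift i a) b)               ≡⟨ toℕ-shift (shift i a) b ⟩
      (toℕ (shift i a) ℕ.+ b) % k             ≡⟨ cong (λ x → (x ℕ.+ b) % k) (toℕ-shift i a) ⟩
      ((toℕ i ℕ.+ a) % k ℕ.+ b) % k           ≡⟨ %-distribˡ-+ ((toℕ i ℕ.+ a) % k) b k ⟩
      ((toℕ i ℕ.+ a) % k % k ℕ.+ b % k) % k   ≡⟨ cong (λ x → (x ℕ.+ b % k) % k) (m%n%n≡m%n (toℕ i ℕ.+ a) k) ⟩
      ((toℕ i ℕ.+ a) % k ℕ.+ b % k) % k       ≡⟨ %-distribˡ-+ (toℕ i ℕ.+ a) b k ⟨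
      (toℕ i ℕ.+ a ℕ.+ b) % k                 ≡⟨ cong (_% k) (ℕP.+-assoc (toℕ i) a b) ⟩
      (toℕ i ℕ.+ (a ℕ.+ b)) % k               ≡⟨ toℕ-shift i (a ℕ.+ b) ⟨
      toℕ (shift i (a ℕ.+ b))                 ∎)
      where open ≡-Reasoning

    shift-0 : ∀ (i : Fin k) → shift i 0 ≡ i
    shift-0 i = FinP.toℕ-injective (trans (toℕ-shift i 0)
      (trans (cong (_% k) (ℕP.+-identityʳ (toℕ i))) (m<n⇒m%n≡m (FinP.toℕ<n i))))

    shift-≢ : ∀ (i : Fin k) {m} → 0 ℕ.< m → m ℕ.< k → shift i m ≢ i
    shift-≢ i {m} 0<m m<k eq with (toℕ i ℕ.+ m) / k | m≡[i+m]/k*k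
      where
      m≡[i+m]/k*k : m ≡ ((toℕ i ℕ.+ m) / k) ℕ.* k
      m≡[i+m]/k*k = ℕP.+-cancelˡ-≡ (toℕ i) m _ (begin
        toℕ i ℕ.+ m
          ≡⟨ m≡m%n+[m/n]*n (toℕ i ℕ.+ m) k ⟩
        (toℕ i ℕ.+ m) % k ℕ.+ (toℕ i ℕ.+ m) / k ℕ.* k
          ≡⟨ cong (ℕ._+ (toℕ i ℕ.+ m) / k ℕ.* k) (trans (sym (toℕ-shift i m)) (cong toℕ eq)) ⟩
        toℕ i ℕ.+ (toℕ i ℕ.+ m) / k ℕ.* k ∎)
        where open ≡-Reasoning
    ... | zero  | m≡0     = ℕP.<-irrefl (sym m≡0) 0<m
    ... | suc c | m≡k+c*k =
      ℕP.<-irrefl refl (ℕP.<-≤-trans m<k (subst (k ℕ.≤_) (sym m≡k+c*k) (ℕP.m≤m+n k (c ℕ.* k))))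

    shift-inject₁ : ∀ (i : Fin n) → shift (inject₁ i) 1 ≡ Fin.suc i
    shift-inject₁ i = FinP.toℕ-injective (trans (toℕ-shift (inject₁ i) 1)
      (trans (cong (_% k) (trans (cong (ℕ._+ 1) (FinP.toℕ-inject₁ i)) (ℕP.+-comm (toℕ i) 1)))
        (m<n⇒m%n≡m (s≤s (FinP.toℕ<n i)))))

    shift-fromℕ : shift (fromℕ n) 1 ≡ Fin.zero
    shift-fromℕ = FinP.toℕ-injective (trans (toℕ-shift (fromℕ n) 1)
      (trans (cong (_% k) (trans (cong (ℕ._+ 1) (FinP.toℕ-fromℕ n)) (ℕP.+-comm n 1))) (n%n≡0 k)))

    sumFin-shift1 : ∀ (g : Fin k → ℚ) → sumFin k (λ i → g (shift i 1)) ≡ sumFin k g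
    sumFin-shift1 g = trans (sumFin-last n (λ i → g (shift i 1)))
      (trans (cong₂ _+_ (sumFin-cong n (λ i → cong g (shift-inject₁ i))) (cong g shift-fromℕ))
        (+-comm _ (g Fin.zero)))

    sumFin-shift : ∀ m (g : Fin k → ℚ) → sumFin k (λ i → g (shift i m)) ≡ sumFin k g
    sumFin-shift zero    g = sumFin-cong k (λ i → cong g (shift-0 i))
    sumFin-shift (suc m) g = trans (sumFin-cong k (λ i → cong g (sym (shift-+ i 1 m))))
      (trans (sumFin-shift1 (λ i → g (shift i m))) (sumFin-shift m g))

  module _ {k : ℕ} where

    triangleSum : (Fin k → Fin k → ℚ) → Fin k → Fin k → Fin k → ℚ
    triangleSum F a b c = F a b + F b c - F a c

    sumEdges-zero : sumEdges k (λ _ _ → 0ℚ) ≡ 0ℚ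
    sumEdges-zero = trans (sumFin-cong k (λ i → trans (sumFin-cong k (λ j → if-const (i <ᵇ j))) (sumFin-zero k)))
      (sumFin-zero k)
      where
      if-const : ∀ b → (if b then 0ℚ else 0ℚ) ≡ 0ℚ
      if-const true  = refl
      if-const false = refl

    δ³ : Fin k → Fin k → Fin k → Fin k → Fin k → Fin k → ℚ
    δ³ x y z a b c = ind (a == x) * (ind (b == y) * ind (c == z))

    sumTriples-δ³ : ∀ {x y z} → distinct3 x y z ≡ true → (f : Fin k → Fin k → Fin k → ℚ) →
      sumTriples k (λ a b c → δ³ x y z a b c * f a b c) ≡ f x y z
    sumTriples-δ³ {x} {y} {z} xyz f = begin
      sumTriples k (λ a b c → δ³ x y z a b c * f a b c)
        ≡⟨ sumFin-cong k (λ a → sumFin-cong k (λ b → sumFin-cong k (λ c → if-*-distrib a b c (distinct3 a b c)))) ⟩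
      sumFin k (λ a → sumFin k (λ b → sumFin k (λ c → ind (a == x) * (ind (b == y) * (ind (c == z) * g a b c)))))
        ≡⟨ sumFin-cong k (λ a → sumFin-cong k (λ b → trans (sumFin-*ˡ k (ind (a == x)) _)
             (cong (ind (a == x) *_) (trans (sumFin-*ˡ k (ind (b == y)) _)
               (cong (ind (b == y) *_) (sumFin-δ k z (g a b))))))) ⟩
      sumFin k (λ a → sumFin k (λ b → ind (a == x) * (ind (b == y) * g a b z)))
        ≡⟨ sumFin-cong k (λ a → trans (sumFin-*ˡ k (ind (a == x)) _)
             (cong (ind (a == x) *_) (sumFin-δ k y (λ b → g a b z)))) ⟩
      sumFin k (λ a → ind (a == x) * g a y z)
        ≡⟨ sumFin-δ k x (λ a → g a y z) ⟩
      g x y z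
        ≡⟨ cong (λ d → if d then f x y z else 0ℚ) xyz ⟩
      f x y z ∎
      where
      open ≡-Reasoning
      g : Fin k → Fin k → Fin k → ℚ
      g a b c = if distinct3 a b c then f a b c else 0ℚ
      if-*-distrib : ∀ a b c d → (if d then δ³ x y z a b c * f a b c else 0ℚ)
                                 ≡ ind (a == x) * (ind (b == y) * (ind (c == z) * (if d then f a b c else 0ℚ)))
      if-*-distrib a b c true = solve 4 (λ u v w e → (u :* (v :* w)) :* e := u :* (v :* (w :* e))) refl
        (ind (a == x)) (ind (b == y)) (ind (c == z)) (f a b c)
      if-*-distrib a b c false = sym (solve 3 (λ u v w → u :* (v :* (w :* con 0ℚ)) := con 0ℚ) refl
        (ind (a == x)) (ind (b == y)) (ind (c == z)))

    sumTriples-cong : ∀ {f g : Fin k → Fin k → Fin k → ℚ} → (∀ a b c → f a b c ≡ g a b c) →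
      sumTriples k f ≡ sumTriples k g
    sumTriples-cong f≡g = sumFin-cong k (λ a → sumFin-cong k (λ b → sumFin-cong k (λ c →
      cong (λ x → if distinct3 a b c then x else 0ℚ) (f≡g a b c))))

    sumTriples-sumFin : ∀ m (g : Fin m → Fin k → Fin k → Fin k → ℚ) →
      sumTriples k (λ a b c → sumFin m (λ s → g s a b c)) ≡ sumFin m (λ s → sumTriples k (g s))
    sumTriples-sumFin m g = begin
      sumTriples k (λ a b c → sumFin m (λ s → g s a b c))
        ≡⟨ sumFin-cong k (λ a → sumFin-cong k (λ b → sumFin-cong k (λ c → if-sumFin (distinct3 a b c)))) ⟩
      sumFin k (λ a → sumFin k (λ b → sumFin k (λ c → sumFin m (λ s → g̃ s a b c))))
        ≡⟨ sumFin-cong k (λ a → sumFin-cong k (λ b → sumFin-comm k m (λ c s → g̃ s a b c))) ⟩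
      sumFin k (λ a → sumFin k (λ b → sumFin m (λ s → sumFin k (g̃ s a b))))
        ≡⟨ sumFin-cong k (λ a → sumFin-comm k m (λ b s → sumFin k (g̃ s a b))) ⟩
      sumFin k (λ a → sumFin m (λ s → sumFin k (λ b → sumFin k (g̃ s a b))))
        ≡⟨ sumFin-comm k m (λ a s → sumFin k (λ b → sumFin k (g̃ s a b))) ⟩
      sumFin m (λ s → sumTriples k (g s)) ∎
      where
      open ≡-Reasoning
      g̃ : Fin m → Fin k → Fin k → Fin k → ℚ
      g̃ s a b c = if distinct3 a b c then g s a b c else 0ℚ
      if-sumFin : ∀ {a b c} d → (if d then sumFin m (λ s → g s a b c) else 0ℚ)
                              ≡ sumFin m (λ s → if d then g s a b c else 0ℚ)
      if-sumFin true  = refl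
      if-sumFin false = sym (sumFin-zero m)

  module _ {n : ℕ} where

    private
      k = suc n

    cycleSum : (Fin k → Fin k → ℚ) → ℕ → ℚ
    cycleSum F d = sumFin k (λ t → F t (shift t d))

    -- The fan at apex i: triangles (i, i+j, i+j+1), 1 ≤ j ≤ p, where j : Fin p stands for the offset j + 1.
    fanMid : ∀ {p} → Fin k → Fin p → Fin k
    fanMid i j = shift i (suc (toℕ j))

    fanEnd : ∀ {p} → Fin k → Fin p → Fin k
    fanEnd i j = shift (fanMid i j) 1

    fanEnd≡shift : ∀ {p} (i : Fin k) (j : Fin p) → fanEnd i j ≡ shift i (suc (suc (toℕ j)))
    fanEnd≡shift i j = trans (shift-+ i (suc (toℕ j)) 1) (cong (shift i) (ℕP.+-comm (suc (toℕ j)) 1))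

    sumFin-fan : ∀ p (F : Fin k → Fin k → ℚ) (i : Fin k) →
      sumFin p (λ j → triangleSum F i (fanMid i j) (fanEnd i j))
        ≡ sumFin (suc p) (λ m → F (shift i (toℕ m)) (shift (shift i (toℕ m)) 1)) - F i (shift i (suc p))
    sumFin-fan p F i = begin
      sumFin p (λ j → triangleSum F i (fanMid i j) (fanEnd i j))
        ≡⟨ sumFin-cong p (λ j → cong (λ c → a (toℕ j) + b (toℕ j) - F i c) (fanEnd≡shift i j)) ⟩
      sumFin p (λ j → a (toℕ j) + b (toℕ j) - a (suc (toℕ j)))
        ≡⟨ sumFin-telescope p a b ⟩
      a 0 - a p + sumFin p (λ j → b (toℕ j))
        ≡⟨ cong (λ t → F t (shift t 1) - a p + sumFin p (λ j → b (toℕ j))) (sym (shift-0 i)) ⟩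
      F (shift i 0) (shift (shift i 0) 1) - a p + sumFin p (λ j → b (toℕ j))
        ≡⟨ solve 3 (λ x y s → x :- y :+ s := (x :+ s) :- y) refl
             (F (shift i 0) (shift (shift i 0) 1)) (a p) (sumFin p (λ j → b (toℕ j))) ⟩
      sumFin (suc p) (λ m → F (shift i (toℕ m)) (shift (shift i (toℕ m)) 1)) - a p ∎
      where
      open ≡-Reasoning
      a b : ℕ → ℚ
      a m = F i (shift i (suc m))
      b m = F (shift i (suc m)) (shift (shift i (suc m)) 1)

    sumFin-fans : ∀ p (F : Fin k → Fin k → ℚ) →
      sumFin k (λ i → sumFin p (λ j → triangleSum F i (fanMid i j) (fanEnd i j)))
        ≡ ι (ℤ.+ suc p) * cycleSum F 1 - cycleSum F (suc p)
    sumFin-fans p F = begin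
      sumFin k (λ i → sumFin p (λ j → triangleSum F i (fanMid i j) (fanEnd i j)))
        ≡⟨ sumFin-cong k (sumFin-fan p F) ⟩
      sumFin k (λ i → sumFin q (λ m → side m i) - F i (shift i q))
        ≡⟨ sumFin-- k (λ i → sumFin q (λ m → side m i)) (λ i → F i (shift i q)) ⟩
      sumFin k (λ i → sumFin q (λ m → side m i)) - cycleSum F q
        ≡⟨ cong (_- cycleSum F q) (sumFin-comm k q (λ i m → side m i)) ⟩
      sumFin q (λ m → sumFin k (side m)) - cycleSum F q
        ≡⟨ cong (_- cycleSum F q) (sumFin-cong q (λ m → sumFin-shift (toℕ m) (λ t → F t (shift t 1)))) ⟩
      sumFin q (λ _ → cycleSum F 1) - cycleSum F q
        ≡⟨ cong (_- cycleSum F q) (sumFin-const q (cycleSum F 1)) ⟩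
      ι (ℤ.+ q) * cycleSum F 1 - cycleSum F q ∎
      where
      open ≡-Reasoning
      q = suc p
      side : Fin q → Fin k → ℚ
      side m i = F (shift i (toℕ m)) (shift (shift i (toℕ m)) 1)

    fan-distinct3 : ∀ {p} → suc p ℕ.< k → ∀ i (j : Fin p) → distinct3 i (fanMid i j) (fanEnd i j) ≡ true
    fan-distinct3 q<k i j = cong₂ (λ x y → not x ∧ y)
      (dec-false (i Fin.≟ fanMid i j) (λ e → shift-≢ i (s≤s z≤n) 2+j<k (sym e)))
      (cong₂ (λ x y → not x ∧ not y)
        (dec-false (fanMid i j Fin.≟ fanEnd i j) (λ e → shift-≢ (fanMid i j) (s≤s z≤n) 1<k (sym e)))
        (dec-false (i Fin.≟ fanEnd i j) (λ e → shift-≢ i (s≤s z≤n) 3+j<k (sym (trans e (fanEnd≡shift i j))))))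
      where
      3+j<k : suc (suc (toℕ j)) ℕ.< k
      3+j<k = ℕP.≤-<-trans (s≤s (FinP.toℕ<n j)) q<k
      2+j<k : suc (toℕ j) ℕ.< k
      2+j<k = ℕP.<-trans (ℕP.n<1+n _) 3+j<k
      1<k : 1 ℕ.< k
      1<k = ℕP.≤-<-trans (s≤s z≤n) 2+j<k

    fanWeights : ∀ p → ℚ → Fin k → Fin k → Fin k → ℚ
    fanWeights p w a b c = sumFin k (λ i → sumFin p (λ j → w * δ³ i (fanMid i j) (fanEnd i j) a b c))

    fanWeights-nonNeg : ∀ p {w} → 0ℚ ℚ.≤ w → ∀ a b c → 0ℚ ℚ.≤ fanWeights p w a b c
    fanWeights-nonNeg p w≥0 a b c = sumFin-nonNeg k (λ i → sumFin-nonNeg p (λ j →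
      *-nonNeg w≥0 (*-nonNeg (ind-nonNeg (a == i))
        (*-nonNeg (ind-nonNeg (b == fanMid i j)) (ind-nonNeg (c == fanEnd i j))))))

    sumTriples-fanWeights : ∀ {p} → suc p ℕ.< k → ∀ w (T : Fin k → Fin k → Fin k → ℚ) →
      sumTriples k (λ a b c → fanWeights p w a b c * T a b c)
        ≡ w * sumFin k (λ i → sumFin p (λ j → T i (fanMid i j) (fanEnd i j)))
    sumTriples-fanWeights {p} q<k w T = begin
      sumTriples k (λ a b c → fanWeights p w a b c * T a b c)
        ≡⟨ sumTriples-cong {f = λ a b c → fanWeights p w a b c * T a b c} (λ a b c →
             trans (sym (sumFin-*ʳ k (T a b c) (λ i → sumFin p (λ j → w * mass i j a b c))))
               (sumFin-cong k (λ i → trans (sym (sumFin-*ʳ p (T a b c) (λ j → w * mass i j a b c)))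
                 (sumFin-cong p (λ j → solve 3 (λ w d t → (w :* d) :* t := d :* (w :* t)) refl
                    w (mass i j a b c) (T a b c)))))) ⟩
      sumTriples k (λ a b c → sumFin k (λ i → sumFin p (λ j → mass i j a b c * wT a b c)))
        ≡⟨ sumTriples-sumFin k (λ i a b c → sumFin p (λ j → mass i j a b c * wT a b c)) ⟩
      sumFin k (λ i → sumTriples k (λ a b c → sumFin p (λ j → mass i j a b c * wT a b c)))
        ≡⟨ sumFin-cong k (λ i → trans (sumTriples-sumFin p (λ j a b c → mass i j a b c * wT a b c))
             (sumFin-cong p (λ j → sumTriples-δ³ {x = i} {fanMid i j} {fanEnd i j} (fan-distinct3 q<k i j) wT))) ⟩
      sumFin k (λ i → sumFin p (λ j → w * T i (fanMid i j) (fanEnd i j)))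
        ≡⟨ trans (sumFin-cong k (λ i → sumFin-*ˡ p w (λ j → T i (fanMid i j) (fanEnd i j))))
             (sumFin-*ˡ k w (λ i → sumFin p (λ j → T i (fanMid i j) (fanEnd i j)))) ⟩
      w * sumFin k (λ i → sumFin p (λ j → T i (fanMid i j) (fanEnd i j))) ∎
      where
      open ≡-Reasoning
      mass : Fin k → Fin p → Fin k → Fin k → Fin k → ℚ
      mass i j = δ³ i (fanMid i j) (fanEnd i j)
      wT : Fin k → Fin k → Fin k → ℚ
      wT a b c = w * T a b c

  module _ {k : ℕ} where

    -- `entry` compares `toℕ a ℕ.<ᵇ toℕ b`, hence the case split on that boolean.
    entry-edge : ∀ {a b : Fin k} → a ≢ b →
      ∃₂ λ i j → i Fin.< j × (∀ (y : Fin k → Fin k → ℚ) → entry y a b ≡ y i j)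
    entry-edge {a} {b} a≢b with toℕ a ℕ.<ᵇ toℕ b in a<ᵇb
    ... | true  = a , b , ℕP.<ᵇ⇒< (toℕ a) (toℕ b) (subst T (sym a<ᵇb) tt) , λ y → refl
    ... | false = b , a , FinP.≤∧≢⇒< (ℕP.≮⇒≥ (λ a<b → subst T a<ᵇb (ℕP.<⇒<ᵇ a<b))) (a≢b ∘ sym)
                , λ y → refl

    entry-cong : ∀ {x y : Fin k → Fin k → ℚ} → (∀ i j → i Fin.< j → x i j ≡ y i j) →
      ∀ {a b} → a ≢ b → entry x a b ≡ entry y a b
    entry-cong x≡y a≢b with entry-edge a≢b
    ... | i , j , i<j , entry≡ = trans (entry≡ _) (trans (x≡y i j i<j) (sym (entry≡ _)))

    vertex-entry-binary : ∀ {v} → IsCPPVertex k v → ∀ {a b} → a ≢ b → Binary (entry v a b)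
    vertex-entry-binary {v} V a≢b with entry-edge a≢b
    ... | i , j , i<j , entry≡ = subst Binary (sym (entry≡ v)) (IsCPPVertex.binary V i j i<j)

    entry-combo-[] : ∀ (a b : Fin k) → entry (combo []) a b ≡ 0ℚ
    entry-combo-[] a b with toℕ a ℕ.<ᵇ toℕ b
    ... | true  = refl
    ... | false = refl

    entry-combo-∷ : ∀ w v (L : List (ℚ × (Fin k → Fin k → ℚ))) (a b : Fin k) →
      entry (combo ((w , v) ∷ L)) a b ≡ w * entry v a b + entry (combo L) a b
    entry-combo-∷ w v L a b with toℕ a ℕ.<ᵇ toℕ b
    ... | true  = refl
    ... | false = refl

    weightedSum : ((Fin k → Fin k → ℚ) → ℚ) → List (ℚ × (Fin k → Fin k → ℚ)) → ℚ
    weightedSum f []             = 0ℚ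
    weightedSum f ((w , v) ∷ L) = w * f v + weightedSum f L

    weightedSum-≤ : ∀ {f c L} → AllConvex L → (∀ v → IsCPPVertex k v → f v ℚ.≤ c) →
      weightedSum f L ℚ.≤ sumW L * c
    weightedSum-≤ {c = c} [] _ = ≤-reflexive (sym (*-zeroˡ c))
    weightedSum-≤ {f} {c} {(w , v) ∷ L} ((w≥0 , V) ∷ conv) f≤c = begin
      w * f v + weightedSum f L   ≤⟨ +-mono-≤ (*-monoˡ-≤-nonNeg w {{ℚ.nonNegative w≥0}} (f≤c v V))
                                               (weightedSum-≤ conv f≤c) ⟩
      w * c + sumW L * c          ≡⟨ *-distribʳ-+ c w (sumW L) ⟨
      (w + sumW L) * c            ∎
      where open ≤-Reasoning

  module _ {n : ℕ} where

    private
      k = suc n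

    cutLhs-combo : ∀ q L → cutLhs k q (combo L) ≡ weightedSum (cutLhs k q) L
    cutLhs-combo q [] = trans (sumFin-cong k (λ t →
        trans (cong₂ _-_ (entry-combo-[] t (shift t 1)) (entry-combo-[] t (shift t q))) (+-inverseʳ 0ℚ)))
      (sumFin-zero k)
    cutLhs-combo q ((w , v) ∷ L) = begin
      cutLhs k q (combo ((w , v) ∷ L))
        ≡⟨ sumFin-cong k (λ t →
             trans (cong₂ _-_ (entry-combo-∷ w v L t (shift t 1)) (entry-combo-∷ w v L t (shift t q)))
             (solve 5 (λ w a b c d → (w :* a :+ c) :- (w :* b :+ d) := w :* (a :- b) :+ (c :- d)) refl
                w (e v t 1) (e v t q) (e (combo L) t 1) (e (combo L) t q))) ⟩
      sumFin k (λ t → w * (e v t 1 - e v t q) + (e (combo L) t 1 - e (combo L) t q))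
        ≡⟨ sumFin-+ k (λ t → w * (e v t 1 - e v t q)) (λ t → e (combo L) t 1 - e (combo L) t q) ⟩
      sumFin k (λ t → w * (e v t 1 - e v t q)) + cutLhs k q (combo L)
        ≡⟨ cong₂ _+_ (sumFin-*ˡ k w (λ t → e v t 1 - e v t q)) (cutLhs-combo q L) ⟩
      w * cutLhs k q v + weightedSum (cutLhs k q) L ∎
      where
      open ≡-Reasoning
      e : (Fin k → Fin k → ℚ) → Fin k → ℕ → ℚ
      e x t d = entry x t (shift t d)

    cutLhs-≤-InCPP : ∀ {q c} → 0 ℕ.< q → q ℕ.< k → (∀ v → IsCPPVertex k v → cutLhs k q v ℚ.≤ c) →
      ∀ x → InCPP k x → cutLhs k q x ℚ.≤ c
    cutLhs-≤-InCPP {q} {c} 0<q q<k vertex≤c x (L , conv , sumW≡1 , x≡combo) = begin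
      cutLhs k q x
        ≡⟨ sumFin-cong k (λ t → cong₂ _-_ (on-edge t 1 (s≤s z≤n) 1<k) (on-edge t q 0<q q<k)) ⟩
      cutLhs k q (combo L)         ≡⟨ cutLhs-combo q L ⟩
      weightedSum (cutLhs k q) L   ≤⟨ weightedSum-≤ conv vertex≤c ⟩
      sumW L * c                   ≡⟨ cong (_* c) sumW≡1 ⟩
      1ℚ * c                       ≡⟨ *-identityˡ c ⟩
      c                            ∎
      where
      open ≤-Reasoning
      1<k : 1 ℕ.< k
      1<k = ℕP.≤-<-trans 0<q q<k
      on-edge : ∀ t d → 0 ℕ.< d → d ℕ.< k → entry x t (shift t d) ≡ entry (combo L) t (shift t d)
      on-edge t d 0<d d<k = entry-cong x≡combo (λ t≡ → shift-≢ t 0<d d<k (sym t≡))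

  module _ {n p : ℕ} (q<k : suc p ℕ.< suc n) where

    private
      k = suc n
      q = suc p
      P = ι (ℤ.+ p)
      Q = ι (ℤ.+ q)
      w = ℤ.+ 1 ℚ./ q

      w*Q≡1 : w * Q ≡ 1ℚ
      w*Q≡1 = /-*-cancel (ℤ.+ 1) p

      Q≡1+P : Q ≡ 1ℚ + P
      Q≡1+P = ι-+ 1ℤ (ℤ.+ p)

      w*[1+P]≡1 : w * (1ℚ + P) ≡ 1ℚ
      w*[1+P]≡1 = trans (cong (w *_) (sym Q≡1+P)) w*Q≡1

      w≥0 : 0ℚ ℚ.≤ w
      w≥0 = nonNegative⁻¹ w {{normalize-nonNeg 1 q}}

      P*w≥0 : 0ℚ ℚ.≤ P * w
      P*w≥0 = *-nonNeg (ι-mono-≤ (ℤ.+≤+ z≤n)) w≥0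

      cut-split : ∀ G H → w * (Q * G - H) - (P * w) * H ≡ G - H
      cut-split G H = begin
        w * (Q * G - H) - (P * w) * H
          ≡⟨ cong (λ Q → w * (Q * G - H) - (P * w) * H) Q≡1+P ⟩
        w * ((1ℚ + P) * G - H) - (P * w) * H
          ≡⟨ solve 4 (λ w P G H → w :* ((con 1ℚ :+ P) :* G :- H) :- (P :* w) :* H
                                  := (w :* (con 1ℚ :+ P)) :* G :- (w :* (con 1ℚ :+ P)) :* H) refl w P G H ⟩
        (w * (1ℚ + P)) * G - (w * (1ℚ + P)) * H
          ≡⟨ cong (λ c → c * G - c * H) w*[1+P]≡1 ⟩
        1ℚ * G - 1ℚ * H
          ≡⟨ cong₂ _-_ (*-identityˡ G) (*-identityˡ H) ⟩
        G - H ∎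
        where open ≡-Reasoning

      pairIndicator : Fin k → Fin k → Fin k → Fin k → ℚ
      pairIndicator i j a b = ind (samePair a b i j)

      μlo μup : Fin k → Fin k → ℚ
      μlo i j = (P * w) * cycleSum (pairIndicator i j) q
      μup i j = 0ℚ

      τ : Fin k → Fin k → Fin k → ℚ
      τ = fanWeights p w

      fanRhs : ℚ
      fanRhs = w * sumFin k (λ _ → sumFin p (λ _ → 1ℚ))

      combCoeff≡cutCoeff : ∀ i j → combCoeff k μlo μup τ i j ≡ cutCoeff k q i j
      combCoeff≡cutCoeff i j = begin
        (- μlo i j) + 0ℚ + sumTriples k (λ a b c → τ a b c * triangleSum E a b c)
          ≡⟨ cong ((- μlo i j) + 0ℚ +_)
               (trans (sumTriples-fanWeights q<k w (triangleSum E)) (cong (w *_) (sumFin-fans p E))) ⟩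
        (- ((P * w) * H)) + 0ℚ + w * (Q * G - H)
          ≡⟨ solve 5 (λ P w Q G H → (:- ((P :* w) :* H)) :+ con 0ℚ :+ w :* (Q :* G :- H)
                                   := w :* (Q :* G :- H) :- (P :* w) :* H) refl P w Q G H ⟩
        w * (Q * G - H) - (P * w) * H
          ≡⟨ cut-split G H ⟩
        G - H
          ≡⟨ sumFin-- k (λ t → E t (shift t 1)) (λ t → E t (shift t q)) ⟨
        cutCoeff k q i j ∎
        where
        open ≡-Reasoning
        E = pairIndicator i j
        G = cycleSum E 1
        H = cycleSum E q

      combRhs≡fanRhs : combRhs k μlo μup τ ≡ fanRhs
      combRhs≡fanRhs = begin
        sumEdges k μup + sumTriples k τ
          ≡⟨ cong₂ _+_ (sumEdges-zero {k = k})
                       (sumTriples-cong {f = τ} (λ a b c → sym (*-identityʳ (τ a b c)))) ⟩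
        0ℚ + sumTriples k (λ a b c → τ a b c * 1ℚ)
          ≡⟨ +-identityˡ _ ⟩
        sumTriples k (λ a b c → τ a b c * 1ℚ)
          ≡⟨ sumTriples-fanWeights q<k w (λ _ _ _ → 1ℚ) ⟩
        fanRhs ∎
        where open ≡-Reasoning

      k/q≡ι[k]*w : ℤ.+ k ℚ./ q ≡ ι (ℤ.+ k) * w
      k/q≡ι[k]*w = begin
        r              ≡⟨ trans (sym (*-identityʳ r)) (cong (r *_) (sym w*Q≡1)) ⟩
        r * (w * Q)    ≡⟨ solve 3 (λ r w Q → r :* (w :* Q) := (r :* Q) :* w) refl r w Q ⟩
        (r * Q) * w    ≡⟨ cong (_* w) (/-*-cancel (ℤ.+ k) p) ⟩
        ι (ℤ.+ k) * w  ∎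
        where
        open ≡-Reasoning
        r = ℤ.+ k ℚ./ q

      fanRhs≡ : fanRhs ≡ ι (ℤ.+ k) - ℤ.+ k ℚ./ q
      fanRhs≡ = begin
        w * sumFin k (λ _ → sumFin p (λ _ → 1ℚ))
          ≡⟨ cong (w *_) (trans (sumFin-cong k (λ _ → sumFin-const p 1ℚ)) (sumFin-const k (P * 1ℚ))) ⟩
        w * (K * (P * 1ℚ))
          ≡⟨ solve 3 (λ w K P → w :* (K :* (P :* con 1ℚ)) := K :* (w :* (con 1ℚ :+ P)) :- K :* w) refl w K P ⟩
        K * (w * (1ℚ + P)) - K * w
          ≡⟨ cong₂ (λ c r → K * c - r) w*[1+P]≡1 (sym k/q≡ι[k]*w) ⟩
        K * 1ℚ - ℤ.+ k ℚ./ q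
          ≡⟨ cong (_- ℤ.+ k ℚ./ q) (*-identityʳ K) ⟩
        K - ℤ.+ k ℚ./ q ∎
        where
        open ≡-Reasoning
        K = ι (ℤ.+ k)

      floor-fanRhs : floor fanRhs ≡ cutRhs k q
      floor-fanRhs = begin
        floor fanRhs                 ≡⟨ cong floor fanRhs≡ ⟩
        floor (ι (ℤ.+ k) + - r)      ≡⟨ floor-ι+ (ℤ.+ k) (- r) ⟩
        ℤ.+ k ℤ.+ floor (- r)        ≡⟨ cong (λ z → ℤ.+ k ℤ.+ z) (ℤP.neg-involutive (floor (- r))) ⟨
        ℤ.+ k ℤ.- ℤ.- floor (- r)    ≡⟨ cong (λ z → ℤ.+ k ℤ.- z) (ceiling≡-floor- r) ⟨
        cutRhs k q                   ∎
        where
        open ≡-Reasoning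
        r = ℤ.+ k ℚ./ q

      shift-1≢ : ∀ t → t ≢ shift t 1
      shift-1≢ t t≡ = shift-≢ t (s≤s z≤n) (ℕP.≤-<-trans (s≤s z≤n) q<k) (sym t≡)

      shift-q≢ : ∀ t → t ≢ shift t q
      shift-q≢ t t≡ = shift-≢ t (s≤s z≤n) q<k (sym t≡)

      cutLhs-≤-fanRhs : ∀ {v} → IsCPPVertex k v → cutLhs k q v ℚ.≤ fanRhs
      cutLhs-≤-fanRhs {v} V = begin
        cutLhs k q v
          ≡⟨ sumFin-- k (λ t → E t (shift t 1)) (λ t → E t (shift t q)) ⟩
        G - H
          ≡⟨ cut-split G H ⟨
        w * (Q * G - H) - (P * w) * H
          ≤⟨ +-monoʳ-≤ (w * (Q * G - H)) (neg-antimono-≤ (*-nonNeg P*w≥0 H≥0)) ⟩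
        w * (Q * G - H) + - 0ℚ
          ≡⟨ +-identityʳ _ ⟩
        w * (Q * G - H)
          ≡⟨ cong (w *_) (sumFin-fans p E) ⟨
        w * sumFin k (λ i → sumFin p (λ j → triangleSum E i (fanMid i j) (fanEnd i j)))
          ≤⟨ *-monoˡ-≤-nonNeg w {{ℚ.nonNegative w≥0}} (sumFin-mono-≤ k (λ i → sumFin-mono-≤ p (λ j →
               IsCPPVertex.triangle V i (fanMid i j) (fanEnd i j) (fan-distinct3 q<k i j)))) ⟩
        fanRhs ∎
        where
        open ≤-Reasoning
        E = entry v
        G = cycleSum E 1
        H = cycleSum E q
        H≥0 : 0ℚ ℚ.≤ H
        H≥0 = sumFin-nonNeg k (λ t → binary⇒nonNeg (vertex-entry-binary V (shift-q≢ t)))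

      cutLhs-≤-cutRhs : ∀ v → IsCPPVertex k v → cutLhs k q v ℚ.≤ cutRhs k q ℚ./ 1
      cutLhs-≤-cutRhs v V = begin
        cutLhs k q v       ≤⟨ integral-≤-floor cutLhs-integral (cutLhs-≤-fanRhs V) ⟩
        ι (floor fanRhs)   ≡⟨ cong ι floor-fanRhs ⟩
        ι (cutRhs k q)     ≡⟨ /1≡ι (cutRhs k q) ⟨
        cutRhs k q ℚ./ 1   ∎
        where
        open ≤-Reasoning
        cutLhs-integral : Integral (cutLhs k q v)
        cutLhs-integral = integral-sumFin k (λ t →
          integral-- (binary⇒integral (vertex-entry-binary V (shift-1≢ t)))
                     (binary⇒integral (vertex-entry-binary V (shift-q≢ t))))

    fanCut : IsCGCut k (cutCoeff k q) (cutRhs k q)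
    fanCut = record
      { μlo    = μlo
      ; μup    = μup
      ; τ      = τ
      ; μlo≥0  = λ i j → *-nonNeg P*w≥0 (sumFin-nonNeg k (λ t → ind-nonNeg (samePair t (shift t q) i j)))
      ; μup≥0  = λ _ _ → ≤-refl
      ; τ≥0    = fanWeights-nonNeg p w≥0
      ; coeffs = λ i j _ → combCoeff≡cutCoeff i j
      ; rhs    = trans (cong floor combRhs≡fanRhs) floor-fanRhs
      }

    fanCut-valid : ∀ x → InCPP k x → cutLhs k q x ℚ.≤ cutRhs k q ℚ./ 1
    fanCut-valid = cutLhs-≤-InCPP (s≤s z≤n) q<k cutLhs-≤-cutRhs

open import Defs
open import Data.Nat using (ℕ; _≤_; _<_; _*_; zero; suc; z≤n; s≤s)
import Data.Nat.Properties as ℕP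
open import Data.Product using (_×_; _,_)
open import Data.Rational as ℚ using (ℚ)
open import Data.Fin using (Fin)
open import Relation.Binary.PropositionalEquality using (subst)
open FanCertificate using (fanCut; fanCut-valid)

lemma2 : (k q : ℕ) → 2 ≤ q → 2 * q ≤ k →
    IsCGCut k (cutCoeff k q) (cutRhs k q)
    × ((x : Fin k → Fin k → ℚ) → InCPP k x → cutLhs k q x ℚ.≤ (cutRhs k q ℚ./ 1))
lemma2 k       zero    ()
lemma2 zero    (suc p) _ ()
lemma2 (suc n) (suc p) _ 2q≤k = fanCut q<k , fanCut-valid q<k
  where
  q<k : suc p < suc n
  q<k = ℕP.<-≤-trans (subst (suc p <_) (ℕP.*-comm (suc p) 2) (ℕP.m<m*n (suc p) 2 (s≤s (s≤s z≤n)))) 2q≤k
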